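{- Let $G$ be a minimal counterexample (as defined in the context). Then $G$ has no 3-face whose three boundary vertices all have degree 4.
   Context: All graphs are finite and simple. A 2-distance 17-coloring of $G$ is a map $\phi:V(G)\to\{1,\dots,17\}$ with $\phi(u)\ne\phi(w)$ whenever $u\neq w$ and $\mathrm{dist}_G(u,w)\le 2$; $\chi_2(G)$ is the least $k$ admitting such a coloring with $k$ colors. A minimal counterexample is a plane (embedded planar) graph $G$ with $\Delta(G)\le 5$ and $\chi_2(G)>17$ such that every planar graph $G'$ with $\Delta(G')\le 5$ and $|V(G')|+|E(G')|<|V(G)|+|E(G)|$ satisfies $\chi_2(G')\le 17$. A $k$-face is a face of the embedding whose boundary has $k$ edges. -}

module Defs where

open import Data.Nat using (ℕ; zero; suc; _+_; _*_; _≤_; _<_; _<ᵇ_; _≡ᵇ_)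
open import Data.Fin using (Fin; toℕ) renaming (zero to fzero; suc to fsuc)
open import Data.Bool using (Bool; true; false; if_then_else_; _∧_)
open import Data.Product using (Σ; ∃; _×_; _,_; proj₁; proj₂)
open import Data.Sum using (_⊎_)
open import Relation.Nullary using (¬_)
open import Relation.Binary.PropositionalEquality using (_≡_; _≢_)
open import Relation.Binary.Construct.Closure.ReflexiveTransitive using (Star)

iter : ∀ {A : Set} → (A → A) → ℕ → A → A
iter f zero    x = x
iter f (suc k) x = f (iter f k x)

count : ∀ {n} → (Fin n → Bool) → ℕ
count {zero}  p = 0
count {suc n} p = (if p fzero then 1 else 0) + count (λ i → p (fsuc i))

sumFin : ∀ {n} → (Fin n → ℕ) → ℕ
sumFin {zero}  f = 0
sumFin {suc n} f = f fzero + sumFin (λ i → f (fsuc i))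

-- A finite simple graph on the vertex set Fin n (every finite simple graph
-- is isomorphic to one of these).
record Graph : Set where
  field
    n      : ℕ
    adj    : Fin n → Fin n → Bool
    sym    : ∀ u v → adj u v ≡ adj v u
    irrefl : ∀ u → adj u u ≡ false

module _ (G : Graph) where
  open Graph G

  Adj : Fin n → Fin n → Set
  Adj u v = adj u v ≡ true

  degree : Fin n → ℕ
  degree v = count (adj v)

  -- |E(G)|: unordered adjacent pairs {u,w}, counted once via u < w
  numEdges : ℕ
  numEdges = sumFin (λ u → count (λ w → adj u w ∧ (toℕ u <ᵇ toℕ w)))

  numIsolated : ℕ
  numIsolated = count (λ v → degree v ≡ᵇ 0)

  size : ℕ
  size = n + numEdges

  MaxDegreeAtMost : ℕ → Set
  MaxDegreeAtMost d = ∀ v → degree v ≤ d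

  Dist≤2 : Fin n → Fin n → Set
  Dist≤2 u w = Adj u w ⊎ (∃ λ x → Adj u x × Adj x w)

  TwoDistColoring : ℕ → Set
  TwoDistColoring k =
    Σ (Fin n → Fin k) λ φ → ∀ u w → u ≢ w → Dist≤2 u w → φ u ≢ φ w

  χ₂≤ : ℕ → Set
  χ₂≤ k = ∃ λ j → j ≤ k × TwoDistColoring j

  Connected : Fin n → Fin n → Set
  Connected = Star Adj

  NumComponents : ℕ → Set
  NumComponents c =
    Σ (Fin n → Fin c) λ ℓ →
      (∀ y → ∃ λ v → ℓ v ≡ y) ×
      (∀ u v → ℓ u ≡ ℓ v → Connected u v) ×
      (∀ u v → Connected u v → ℓ u ≡ ℓ v)

  -- Combinatorial embedding (rotation system): rot u is a cyclic permutation
  -- of the neighbourhood N(u) (values outside N(u) are irrelevant).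
  record RotationSystem : Set where
    field
      rot    : Fin n → Fin n → Fin n
      closed : ∀ u v → Adj u v → Adj u (rot u v)
      cyclic : ∀ u v w → Adj u v → Adj u w → ∃ λ k → iter (rot u) k v ≡ w

  Dart : Set
  Dart = Σ (Fin n × Fin n) λ p → Adj (proj₁ p) (proj₂ p)

  module _ (R : RotationSystem) where
    open RotationSystem R

    faceStep : Fin n × Fin n → Fin n × Fin n
    faceStep (u , v) = (v , rot v u)

    SameFace : Dart → Dart → Set
    SameFace d d' = ∃ λ k → iter faceStep k (proj₁ d) ≡ proj₁ d'

    NumFaces : ℕ → Set
    NumFaces F =
      Σ (Dart → Fin F) λ ℓ →
        (∀ y → ∃ λ d → ℓ d ≡ y) ×
        (∀ d d' → ℓ d ≡ ℓ d' → SameFace d d') ×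
        (∀ d d' → SameFace d d' → ℓ d ≡ ℓ d')

    -- Genus 0 (every component embedded in the sphere): Euler's formula
    -- summed over components, where each non-trivial component satisfies
    -- V - E + F = 2 and isolated vertices have no darts:
    --   n + F + #isolated = |E| + 2 c
    IsPlane : Set
    IsPlane = ∃ λ F → ∃ λ c → NumFaces F × NumComponents c ×
                (n + F + numIsolated ≡ numEdges + 2 * c)

    Is3Face : Dart → Set
    Is3Face d = iter faceStep 3 (proj₁ d) ≡ proj₁ d × faceStep (proj₁ d) ≢ proj₁ d

    boundaryVertices3 : Dart → Fin n × Fin n × Fin n
    boundaryVertices3 d =
      proj₁ (proj₁ d) , proj₁ (faceStep (proj₁ d)) , proj₁ (iter faceStep 2 (proj₁ d))

  Planar : Set
  Planar = Σ RotationSystem IsPlane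

record PlaneGraph : Set where
  field
    graph     : Graph
    embedding : RotationSystem graph
    plane     : IsPlane graph embedding

MinimalCounterexample : PlaneGraph → Set
MinimalCounterexample P =
  MaxDegreeAtMost G 5 × ¬ χ₂≤ G 17 ×
  (∀ (G' : Graph) → Planar G' → MaxDegreeAtMost G' 5 → size G' < size G → χ₂≤ G' 17)
  where G = PlaneGraph.graph P

module Submission where

-- Delete the edge uv of a triangle uvw whose vertices have degree 4.  Tracing faces, the
-- triangle merges with the face on the other side of uv, so G - uv is still plane (Euler's
-- formula loses one edge and one face); it also has maximum degree at most 5 and is smaller,
-- so by minimality it has a 2-distance 17-colouring.  Only pairs involving u or v can be
-- closer in G than in G - uv, so it suffices to recolour u and then v.  Each of them sees at
-- most 16 vertices within distance 2, which leaves a free colour.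

open import Defs
open import Axiom.UniquenessOfIdentityProofs using (module Decidable⇒UIP)
open import Data.Bool using (Bool; true; false; if_then_else_; _∧_; _∨_; not)
import Data.Bool as Bool
open import Data.Bool.Properties using (∧-assoc; ∧-comm; ∧-identityʳ; ∨-comm; not-injective; T-≡)
open import Data.Empty using (⊥-elim)
open import Data.Unit using (⊤; tt)
open import Data.Fin using (Fin; toℕ; punchIn; punchOut; inject≤) renaming (zero to fzero; suc to fsuc)
import Data.Fin.Properties as FP
open import Data.List using (List; []; _∷_; _++_; length; lookup)
open import Data.List.Properties using (length-++)
open import Data.List.Membership.Propositional using (_∈_; _∉_)
open import Data.List.Membership.Propositional.Properties using (∈-++⁺ˡ; ∈-++⁺ʳ)
import Data.List.Membership.DecPropositional as DecMembership
open import Data.List.Relation.Unary.Any using (here; there; index)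
open import Data.List.Relation.Unary.Any.Properties using (lookup-index)
open import Data.Nat using (ℕ; zero; suc; _+_; _*_; _≤_; _<_; z≤n; s≤s; _<ᵇ_; _≡ᵇ_)
open import Data.Nat.Properties
  using (≤-refl; ≤-trans; ≤-reflexive; +-mono-≤; +-suc; *-distribˡ-+; *-zeroʳ; *-identityʳ;
         suc-injective; <ᵇ⇒<; <⇒<ᵇ; <-cmp; <-asym; module ≤-Reasoning)
open import Data.Product using (_×_; _,_; ∃; Σ; proj₁; proj₂)
open import Data.Product.Properties using (≡-dec)
open import Data.Sum using (_⊎_; inj₁; inj₂)
open import Function.Bundles using (Equivalence)
open import Relation.Binary.Definitions using (DecidableEquality; tri<; tri≈; tri>)
open import Relation.Binary.PropositionalEquality
import Relation.Binary.Construct.Closure.ReflexiveTransitive as Star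
open import Relation.Binary.Construct.Closure.ReflexiveTransitive using (Star; ε; _◅_; _⋆)
open import Relation.Nullary using (¬_; Dec; yes; no; does; ¬?; contradiction)
open import Relation.Nullary.Decidable using (dec-true; dec-false; decidable-stable)

_==_ : ∀ {n} → Fin n → Fin n → Bool
i == j = does (i FP.≟ j)

==⇒≡ : ∀ {n} {i j : Fin n} → (i == j) ≡ true → i ≡ j
==⇒≡ {i = i} {j} h with i FP.≟ j
... | yes i≡j = i≡j
... | no _ = contradiction h λ ()

==-refl : ∀ {n} (i : Fin n) → (i == i) ≡ true
==-refl i = dec-true (i FP.≟ i) refl

≢⇒==-false : ∀ {n} {i j : Fin n} → i ≢ j → (i == j) ≡ false
≢⇒==-false {i = i} {j} = dec-false (i FP.≟ j)

∧-intro : ∀ {a b : Bool} → a ≡ true → b ≡ true → (a ∧ b) ≡ true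
∧-intro refl refl = refl

∧-elimˡ : ∀ {a b : Bool} → (a ∧ b) ≡ true → a ≡ true
∧-elimˡ {true} _ = refl

∧-elimʳ : ∀ {a b : Bool} → (a ∧ b) ≡ true → b ≡ true
∧-elimʳ {true} h = h

true≢false : true ≢ false
true≢false ()

≡true-irrelevant : ∀ {b : Bool} (p q : b ≡ true) → p ≡ q
≡true-irrelevant = Decidable⇒UIP.≡-irrelevant Bool._≟_

∧-not-redundant : ∀ a b c → (b ≡ true → c ≡ false) → ((a ∧ not b) ∧ c) ≡ (a ∧ c)
∧-not-redundant false b     c h = refl
∧-not-redundant true  false c h = refl
∧-not-redundant true  true  c h rewrite h refl = refl

∧-not-swap : ∀ a b c → ((a ∧ not b) ∧ c) ≡ ((a ∧ c) ∧ not b)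
∧-not-swap a b c =
  trans (∧-assoc a (not b) c) (trans (cong (a ∧_) (∧-comm (not b) c)) (sym (∧-assoc a c (not b))))

positive⇒≡ᵇ0-false : ∀ {m} → 1 ≤ m → (m ≡ᵇ 0) ≡ false
positive⇒≡ᵇ0-false (s≤s _) = refl

<ᵇ-asym : ∀ {p q} → (p <ᵇ q) ≡ true → (q <ᵇ p) ≡ false
<ᵇ-asym {p} {q} h with q <ᵇ p in e
... | false = refl
... | true = ⊥-elim (<-asym (<ᵇ⇒< p q (Equivalence.from T-≡ h)) (<ᵇ⇒< q p (Equivalence.from T-≡ e)))

ind : Bool → ℕ
ind b = if b then 1 else 0

sumFin-cong : ∀ {n} {f g : Fin n → ℕ} → (∀ i → f i ≡ g i) → sumFin f ≡ sumFin g
sumFin-cong {zero}  h = refl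
sumFin-cong {suc n} h = cong₂ _+_ (h fzero) (sumFin-cong (λ i → h (fsuc i)))

sumFin-mono : ∀ {n} {f g : Fin n → ℕ} → (∀ i → f i ≤ g i) → sumFin f ≤ sumFin g
sumFin-mono {zero}  h = z≤n
sumFin-mono {suc n} h = +-mono-≤ (h fzero) (sumFin-mono (λ i → h (fsuc i)))

sumFin-suc-at : ∀ {n} (f g : Fin n → ℕ) (k : Fin n) →
  f k ≡ suc (g k) → (∀ i → i ≢ k → f i ≡ g i) → sumFin f ≡ suc (sumFin g)
sumFin-suc-at f g fzero    hk ho = cong₂ _+_ hk (sumFin-cong (λ i → ho (fsuc i) (λ ())))
sumFin-suc-at f g (fsuc k) hk ho =
  trans (cong₂ _+_ (ho fzero (λ ()))
                   (sumFin-suc-at (λ i → f (fsuc i)) (λ i → g (fsuc i)) k hk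
                                  (λ i i≢k → ho (fsuc i) (λ e → i≢k (FP.suc-injective e)))))
        (+-suc (g fzero) _)

sumFin-if-const : ∀ {n} (p : Fin n → Bool) (m : ℕ) → sumFin (λ i → if p i then m else 0) ≡ m * count p
sumFin-if-const {zero}  p m = sym (*-zeroʳ m)
sumFin-if-const {suc n} p m =
  trans (cong₂ _+_ (if-const (p fzero)) (sumFin-if-const (λ i → p (fsuc i)) m))
        (sym (*-distribˡ-+ m (ind (p fzero)) _))
  where
  if-const : ∀ b → (if b then m else 0) ≡ m * ind b
  if-const true  = sym (*-identityʳ m)
  if-const false = sym (*-zeroʳ m)

count≡sumFin-ind : ∀ {n} (p : Fin n → Bool) → count p ≡ sumFin (λ i → ind (p i))
count≡sumFin-ind {zero}  p = refl
count≡sumFin-ind {suc n} p = cong (ind (p fzero) +_) (count≡sumFin-ind (λ i → p (fsuc i)))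

count-cong : ∀ {n} {p q : Fin n → Bool} → (∀ i → p i ≡ q i) → count p ≡ count q
count-cong {p = p} {q} h =
  trans (count≡sumFin-ind p) (trans (sumFin-cong (λ i → cong ind (h i))) (sym (count≡sumFin-ind q)))

count-mono : ∀ {n} {p q : Fin n → Bool} → (∀ i → p i ≡ true → q i ≡ true) → count p ≤ count q
count-mono {p = p} {q} h =
  subst₂ _≤_ (sym (count≡sumFin-ind p)) (sym (count≡sumFin-ind q)) (sumFin-mono (λ i → ind-mono (h i)))
  where
  ind-mono : ∀ {a b} → (a ≡ true → b ≡ true) → ind a ≤ ind b
  ind-mono {false} _ = z≤n
  ind-mono {true}  h rewrite h refl = ≤-refl

count-remove : ∀ {n} (p : Fin n → Bool) (k : Fin n) → p k ≡ true →
  count p ≡ suc (count (λ j → p j ∧ not (j == k)))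
count-remove p k pk =
  trans (count≡sumFin-ind p)
        (trans (sumFin-suc-at _ (λ j → ind (p j ∧ not (j == k))) k at-k elsewhere)
               (cong suc (sym (count≡sumFin-ind (λ j → p j ∧ not (j == k))))))
  where
  at-k : ind (p k) ≡ suc (ind (p k ∧ not (k == k)))
  at-k rewrite pk | ==-refl k = refl
  elsewhere : ∀ i → i ≢ k → ind (p i) ≡ ind (p i ∧ not (i == k))
  elsewhere i i≢k rewrite ≢⇒==-false i≢k = cong ind (sym (∧-identityʳ (p i)))

count-pos : ∀ {n} (p : Fin n → Bool) (k : Fin n) → p k ≡ true → 1 ≤ count p
count-pos p k pk rewrite count-remove p k pk = s≤s z≤n

concatFin : ∀ {n} {A : Set} → (Fin n → List A) → List A
concatFin {zero}  f = []
concatFin {suc n} f = f fzero ++ concatFin (λ i → f (fsuc i))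

length-concatFin : ∀ {n} {A : Set} (f : Fin n → List A) →
  length (concatFin f) ≡ sumFin (λ i → length (f i))
length-concatFin {zero}  f = refl
length-concatFin {suc n} f =
  trans (length-++ (f fzero)) (cong (length (f fzero) +_) (length-concatFin (λ i → f (fsuc i))))

∈-concatFin : ∀ {n} {A : Set} (f : Fin n → List A) (i : Fin n) {x : A} → x ∈ f i → x ∈ concatFin f
∈-concatFin f fzero    x∈ = ∈-++⁺ˡ x∈
∈-concatFin f (fsuc i) x∈ = ∈-++⁺ʳ (f fzero) (∈-concatFin (λ j → f (fsuc j)) i x∈)

∈-if-true : ∀ {A : Set} {b : Bool} {x : A} {xs : List A} → b ≡ true → x ∈ xs → x ∈ (if b then xs else [])
∈-if-true refl x∈ = x∈

mapFilter : ∀ {n} {A : Set} → (Fin n → Bool) → (Fin n → A) → List A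
mapFilter P ψ = concatFin (λ y → if P y then ψ y ∷ [] else [])

length-mapFilter : ∀ {n} {A : Set} (P : Fin n → Bool) (ψ : Fin n → A) → length (mapFilter P ψ) ≡ count P
length-mapFilter P ψ =
  trans (length-concatFin (λ y → if P y then ψ y ∷ [] else []))
        (trans (sumFin-cong singleton-length) (sym (count≡sumFin-ind P)))
  where
  singleton-length : ∀ i → length (if P i then ψ i ∷ [] else []) ≡ ind (P i)
  singleton-length i with P i
  ... | true  = refl
  ... | false = refl

∈-mapFilter : ∀ {n} {A : Set} (P : Fin n → Bool) (ψ : Fin n → A) (y : Fin n) → P y ≡ true → ψ y ∈ mapFilter P ψ
∈-mapFilter P ψ y Py = ∈-concatFin (λ y → if P y then ψ y ∷ [] else []) y (∈-if-true Py (here refl))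

module _ {k : ℕ} where
  open DecMembership (FP._≟_ {k}) using (_∈?_)

  covering⇒≮ : (xs : List (Fin k)) → (∀ c → c ∈ xs) → ¬ (length xs < k)
  covering⇒≮ xs mem lt with FP.pigeonhole lt (λ c → index (mem c))
  ... | i , j , i<j , same-index = FP.<⇒≢ i<j (begin
    i                       ≡⟨ lookup-index (mem i) ⟩
    lookup xs (index (mem i)) ≡⟨ cong (lookup xs) same-index ⟩
    lookup xs (index (mem j)) ≡⟨ lookup-index (mem j) ⟨
    j                       ∎)
    where open ≡-Reasoning

  ∃∉-short : (xs : List (Fin k)) → length xs < k → ∃ λ c → c ∉ xs
  ∃∉-short xs lt with FP.any? (λ c → ¬? (c ∈? xs))
  ... | yes found = found
  ... | no none = contradiction lt
                    (covering⇒≮ xs (λ c → decidable-stable (c ∈? xs) (λ c∉xs → none (c , c∉xs))))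

module _ (G : Graph) where
  open Graph G renaming (sym to adj-symmetric)

  adj⇒≢ : ∀ {x y} → adj x y ≡ true → x ≢ y
  adj⇒≢ {x} h refl = true≢false (trans (sym h) (irrefl x))

  adj-sym : ∀ {x y} → adj x y ≡ true → adj y x ≡ true
  adj-sym {x} {y} h = trans (adj-symmetric y x) h

  Dist≤2-sym : ∀ {x y} → Dist≤2 G x y → Dist≤2 G y x
  Dist≤2-sym (inj₁ h)            = inj₁ (adj-sym h)
  Dist≤2-sym (inj₂ (m , h₁ , h₂)) = inj₂ (m , adj-sym h₂ , adj-sym h₁)

  ProperOn : ∀ {k} → (Fin n → Set) → (Fin n → Fin k) → Set
  ProperOn Good ψ = ∀ x y → x ≢ y → Dist≤2 G x y → Good x → Good y → ψ x ≢ ψ y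

  recolour : ∀ {k} → Fin n → Fin k → (Fin n → Fin k) → Fin n → Fin k
  recolour z c ψ x = if x == z then c else ψ x

  recolour-proper : ∀ {k} {Good : Fin n → Set} z c (ψ : Fin n → Fin k) →
    ProperOn (λ x → Good x × x ≢ z) ψ → (∀ y → y ≢ z → Dist≤2 G z y → ψ y ≢ c) →
    ProperOn Good (recolour z c ψ)
  recolour-proper z c ψ proper c-free x y x≢y xy gx gy with x FP.≟ z | y FP.≟ z
  ... | yes refl | yes refl = ⊥-elim (x≢y refl)
  ... | yes refl | no y≢z  = λ c≡ψy → c-free y y≢z xy (sym c≡ψy)
  ... | no x≢z  | yes refl = c-free x x≢z (Dist≤2-sym xy)
  ... | no x≢z  | no y≢z   = proper x y x≢y xy (gx , x≢z) (gy , y≢z)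

  otherNeighbours : Fin n → Fin n → Fin n → Fin n → Bool
  otherNeighbours a b c y = (adj a y ∧ not (y == b)) ∧ not (y == c)

  count-otherNeighbours : ∀ {a b c} → adj a b ≡ true → adj a c ≡ true → b ≢ c → degree G a ≡ 4 →
    count (otherNeighbours a b c) ≡ 2
  count-otherNeighbours {a} {b} {c} ab ac b≢c deg4 = sym (suc-injective (suc-injective (begin
    4                                                         ≡⟨ deg4 ⟨
    count (adj a)                                             ≡⟨ count-remove (adj a) b ab ⟩
    suc (count (λ y → adj a y ∧ not (y == b)))                ≡⟨ cong suc (count-remove _ c c-kept) ⟩
    suc (suc (count (otherNeighbours a b c)))                 ∎)))
    where
    open ≡-Reasoning
    c-kept : (adj a c ∧ not (c == b)) ≡ true
    c-kept = ∧-intro ac (cong not (≢⇒==-false (λ c≡b → b≢c (sym c≡b))))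

-- At a vertex p of a triangle pqr whose vertices all have degree 4, the vertices within
-- distance 2 of p are q, r, the two further neighbours of each of q and r, and the two
-- further neighbours of p together with their at most 4 other neighbours: 2+2+2+2·5 = 16.
module FreeColour (G : Graph) (Δ≤5 : MaxDegreeAtMost G 5) (p q r : Fin (Graph.n G))
  (apq : Graph.adj G p q ≡ true) (apr : Graph.adj G p r ≡ true) (aqr : Graph.adj G q r ≡ true)
  (dp : degree G p ≡ 4) (dq : degree G q ≡ 4) (dr : degree G r ≡ 4) (ψ : Fin (Graph.n G) → Fin 17)
  where
  open Graph G using (n; adj)

  secondRing : Fin n → List (Fin 17)
  secondRing x = if otherNeighbours G p q r x then ψ x ∷ mapFilter (λ y → adj x y ∧ not (y == p)) ψ else []

  nearColours : List (Fin 17)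
  nearColours = ψ q ∷ ψ r ∷ (mapFilter (otherNeighbours G q p r) ψ ++
                             (mapFilter (otherNeighbours G r p q) ψ ++ concatFin secondRing))

  length-secondRing : ∀ x → length (secondRing x) ≤ (if otherNeighbours G p q r x then 5 else 0)
  length-secondRing x with otherNeighbours G p q r x in e
  ... | false = z≤n
  ... | true  = begin
    suc (length (mapFilter (λ y → adj x y ∧ not (y == p)) ψ)) ≡⟨ cong suc (length-mapFilter _ ψ) ⟩
    suc (count (λ y → adj x y ∧ not (y == p)))                 ≡⟨ count-remove (adj x) p (adj-sym G (∧-elimˡ (∧-elimˡ e))) ⟨
    degree G x                                                 ≤⟨ Δ≤5 x ⟩
    5                                                          ∎
    where open ≤-Reasoning

  length-nearColours : length nearColours ≤ 16
  length-nearColours = s≤s (s≤s (begin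
    length (Q ++ (R ++ concatFin secondRing))                ≡⟨ length-++ Q ⟩
    length Q + length (R ++ concatFin secondRing)            ≡⟨ cong (length Q +_) (length-++ R) ⟩
    length Q + (length R + length (concatFin secondRing))    ≤⟨ +-mono-≤ (≤-reflexive lengthQ)
                                                                  (+-mono-≤ (≤-reflexive lengthR) length-ring) ⟩
    2 + (2 + 10)                                             ∎))
    where
    open ≤-Reasoning
    Q = mapFilter (otherNeighbours G q p r) ψ
    R = mapFilter (otherNeighbours G r p q) ψ
    lengthQ : length Q ≡ 2
    lengthQ = trans (length-mapFilter _ ψ) (count-otherNeighbours G (adj-sym G apq) aqr (adj⇒≢ G apr) dq)
    lengthR : length R ≡ 2
    lengthR = trans (length-mapFilter _ ψ)
                    (count-otherNeighbours G (adj-sym G apr) (adj-sym G aqr) (adj⇒≢ G apq) dr)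
    length-ring : length (concatFin secondRing) ≤ 10
    length-ring = begin
      length (concatFin secondRing)                            ≡⟨ length-concatFin secondRing ⟩
      sumFin (λ x → length (secondRing x))                     ≤⟨ sumFin-mono length-secondRing ⟩
      sumFin (λ x → if otherNeighbours G p q r x then 5 else 0) ≡⟨ sumFin-if-const (otherNeighbours G p q r) 5 ⟩
      5 * count (otherNeighbours G p q r)                      ≡⟨ cong (5 *_) (count-otherNeighbours G apq apr (adj⇒≢ G aqr) dp) ⟩
      10                                                       ∎

  ∈-nearColours-Q : ∀ {c} → c ∈ mapFilter (otherNeighbours G q p r) ψ → c ∈ nearColours
  ∈-nearColours-Q c∈ = there (there (∈-++⁺ˡ c∈))

  ∈-nearColours-R : ∀ {c} → c ∈ mapFilter (otherNeighbours G r p q) ψ → c ∈ nearColours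
  ∈-nearColours-R c∈ = there (there (∈-++⁺ʳ (mapFilter (otherNeighbours G q p r) ψ) (∈-++⁺ˡ c∈)))

  ∈-nearColours-ring : ∀ {c} → c ∈ concatFin secondRing → c ∈ nearColours
  ∈-nearColours-ring c∈ =
    there (there (∈-++⁺ʳ (mapFilter (otherNeighbours G q p r) ψ)
                         (∈-++⁺ʳ (mapFilter (otherNeighbours G r p q) ψ) c∈)))

  nearColours-complete : ∀ z → z ≢ p → Dist≤2 G p z → ψ z ∈ nearColours
  nearColours-complete z z≢p (inj₁ pz) with z == q in z=q
  ... | true = here (cong ψ (==⇒≡ z=q))
  ... | false with z == r in z=r
  ...   | true  = there (here (cong ψ (==⇒≡ z=r)))
  ...   | false = ∈-nearColours-ring (∈-concatFin secondRing z
                    (∈-if-true (∧-intro (∧-intro pz (cong not z=q)) (cong not z=r)) (here refl)))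
  nearColours-complete z z≢p (inj₂ (x , px , xz)) with x == q in x=q
  ... | true with z == r in z=r
  ...   | true  = there (here (cong ψ (==⇒≡ z=r)))
  ...   | false = ∈-nearColours-Q (∈-mapFilter _ ψ z
                    (∧-intro (∧-intro (subst (λ t → adj t z ≡ true) (==⇒≡ x=q) xz)
                                      (cong not (≢⇒==-false z≢p)))
                             (cong not z=r)))
  nearColours-complete z z≢p (inj₂ (x , px , xz)) | false with x == r in x=r
  ... | true with z == q in z=q
  ...   | true  = here (cong ψ (==⇒≡ z=q))
  ...   | false = ∈-nearColours-R (∈-mapFilter _ ψ z
                    (∧-intro (∧-intro (subst (λ t → adj t z ≡ true) (==⇒≡ x=r) xz)
                                      (cong not (≢⇒==-false z≢p)))
                             (cong not z=q)))
  nearColours-complete z z≢p (inj₂ (x , px , xz)) | false | false =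
    ∈-nearColours-ring (∈-concatFin secondRing x
      (∈-if-true (∧-intro (∧-intro px (cong not x=q)) (cong not x=r))
                 (there (∈-mapFilter _ ψ z (∧-intro xz (cong not (≢⇒==-false z≢p)))))))

  unusedColour : ∃ λ c → ∀ z → z ≢ p → Dist≤2 G p z → ψ z ≢ c
  unusedColour with ∃∉-short nearColours (s≤s length-nearColours)
  ... | c , c∉ = c , λ z z≢p pz ψz≡c → c∉ (subst (_∈ nearColours) ψz≡c (nearColours-complete z z≢p pz))

module _ {A : Set} (f : A → A) where

  iter-+ : ∀ j k x → iter f (j + k) x ≡ iter f j (iter f k x)
  iter-+ zero    k x = refl
  iter-+ (suc j) k x = cong f (iter-+ j k x)

  iter-sucʳ : ∀ k x → iter f (suc k) x ≡ iter f k (f x)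
  iter-sucʳ zero    x = refl
  iter-sucʳ (suc k) x = cong f (iter-sucʳ k x)

  iter-fixed : ∀ {x} → f x ≡ x → ∀ k → iter f k x ≡ x
  iter-fixed fx≡x zero    = refl
  iter-fixed fx≡x (suc k) = trans (cong f (iter-fixed fx≡x k)) fx≡x

  iter-cong : ∀ {g : A → A} → (∀ x → f x ≡ g x) → ∀ k x → iter f k x ≡ iter g k x
  iter-cong f≗g zero    x = refl
  iter-cong {g} f≗g (suc k) x = trans (f≗g _) (cong g (iter-cong f≗g k x))

module Skipping {A : Set} (f : A → A) (b : A → Bool) where

  skip : A → A
  skip t = if b (f t) then f (f t) else f t

  skip-plain : ∀ {t} → b (f t) ≡ false → skip t ≡ f t
  skip-plain e rewrite e = refl

  skip-jump : ∀ {t} → b (f t) ≡ true → skip t ≡ f (f t)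
  skip-jump e rewrite e = refl

  mutual
    skip-reaches : ∀ k y z → b z ≡ false → iter f k y ≡ z → ∃ λ k' → iter skip k' y ≡ z
    skip-reaches zero    y z bz h = 0 , h
    skip-reaches (suc k) y z bz h with b (f y) in e
    ... | false with skip-reaches k (f y) z bz (trans (sym (iter-sucʳ f k y)) h)
    ...   | k' , h' = suc k' , trans (iter-sucʳ skip k' y) (trans (cong (iter skip k') (skip-plain e)) h')
    skip-reaches (suc k) y z bz h | true = skip-reaches-via k y z e bz (trans (sym (iter-sucʳ f k y)) h)

    skip-reaches-via : ∀ k y z → b (f y) ≡ true → b z ≡ false → iter f k (f y) ≡ z →
      ∃ λ k' → iter skip k' y ≡ z
    skip-reaches-via zero    y z e bz h = contradiction (trans (sym e) (trans (cong b h) bz)) true≢false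
    skip-reaches-via (suc k) y z e bz h
      with skip-reaches k (f (f y)) z bz (trans (sym (iter-sucʳ f k (f y))) h)
    ... | k' , h' = suc k' , trans (iter-sucʳ skip k' y) (trans (cong (iter skip k') (skip-jump e)) h')

-- The darts are the points of X satisfying d, s traces faces on them and `face` labels its
-- orbits, the faces.  The two darts a and b = σ a of one edge (those satisfying e) are removed, where
-- a lies on a triangle not containing b.  Then s', which jumps across the removed edge, has
-- one orbit fewer on the remaining darts: the triangle and the face of b merge into one.
module FaceMerge {X : Set} (_≟X_ : DecidableEquality X) (s σ : X → X) (d e : X → Bool)
  (F' : ℕ) (face : Σ X (λ x → d x ≡ true) → Fin (suc F'))
  (face-surjective : ∀ y → ∃ λ t → face t ≡ y)
  (face-sound : ∀ t t' → face t ≡ face t' → ∃ λ k → iter s k (proj₁ t) ≡ proj₁ t')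
  (face-complete : ∀ t t' → (∃ λ k → iter s k (proj₁ t) ≡ proj₁ t') → face t ≡ face t')
  (s-dart : ∀ x → d x ≡ true → d (s x) ≡ true)
  (s-no-fixpoint : ∀ x → d x ≡ true → s x ≢ x)
  (a b : X) (da : d a ≡ true) (db : d b ≡ true) (ea : e a ≡ true) (eb : e b ≡ true)
  (e⇒a⊎b : ∀ x → e x ≡ true → x ≡ a ⊎ x ≡ b)
  (σa : σ a ≡ b) (σb : σ b ≡ a)
  (triangle : iter s 3 a ≡ a)
  (b≢a : b ≢ a) (b≢sa : b ≢ s a) (b≢ssa : b ≢ s (s a))
  where

  IsDart : X → Set
  IsDart x = d x ≡ true

  Kept : X → Set
  Kept x = (d x ∧ not (e x)) ≡ true

  s' : X → X
  s' x = if e (s x) then s (σ (s x)) else s x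

  face-≡ : ∀ {x y} (p : IsDart x) (q : IsDart y) → x ≡ y → face (x , p) ≡ face (y , q)
  face-≡ p q refl = cong (λ z → face (_ , z)) (≡true-irrelevant p q)

  iter-dart : ∀ k x → IsDart x → IsDart (iter s k x)
  iter-dart zero    x p = p
  iter-dart (suc k) x p = s-dart _ (iter-dart k x p)

  face-iter : ∀ k x (p : IsDart x) → face (iter s k x , iter-dart k x p) ≡ face (x , p)
  face-iter k x p = sym (face-complete (x , p) (iter s k x , iter-dart k x p) (k , refl))

  face-s : ∀ x (p : IsDart x) → face (s x , s-dart x p) ≡ face (x , p)
  face-s = face-iter 1

  faceA faceB : Fin (suc F')
  faceA = face (a , da)
  faceB = face (b , db)

  orbit-a : ∀ k → iter s k a ≡ a ⊎ iter s k a ≡ s a ⊎ iter s k a ≡ s (s a)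
  orbit-a zero = inj₁ refl
  orbit-a (suc k) with orbit-a k
  ... | inj₁ h        = inj₂ (inj₁ (cong s h))
  ... | inj₂ (inj₁ h) = inj₂ (inj₂ (cong s h))
  ... | inj₂ (inj₂ h) = inj₁ (trans (cong s h) triangle)

  faceA-members : ∀ x (p : IsDart x) → face (x , p) ≡ faceA → x ≡ a ⊎ x ≡ s a ⊎ x ≡ s (s a)
  faceA-members x p h with face-sound (a , da) (x , p) (sym h)
  ... | k , eq with orbit-a k
  ... | inj₁ y        = inj₁ (trans (sym eq) y)
  ... | inj₂ (inj₁ y) = inj₂ (inj₁ (trans (sym eq) y))
  ... | inj₂ (inj₂ y) = inj₂ (inj₂ (trans (sym eq) y))

  faceA≢faceB : faceA ≢ faceB
  faceA≢faceB h with faceA-members b db (sym h)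
  ... | inj₁ y        = b≢a y
  ... | inj₂ (inj₁ y) = b≢sa y
  ... | inj₂ (inj₂ y) = b≢ssa y

  e-false : ∀ x → x ≢ a → x ≢ b → e x ≡ false
  e-false x x≢a x≢b with e x in h
  ... | false = refl
  ... | true with e⇒a⊎b x h
  ...   | inj₁ y = ⊥-elim (x≢a y)
  ...   | inj₂ y = ⊥-elim (x≢b y)

  kept : ∀ x → IsDart x → x ≢ a → x ≢ b → Kept x
  kept x p x≢a x≢b = ∧-intro p (cong not (e-false x x≢a x≢b))

  kept⇒dart : ∀ {x} → Kept x → IsDart x
  kept⇒dart = ∧-elimˡ

  kept-≢a : ∀ {x} → Kept x → x ≢ a
  kept-≢a p refl = true≢false (trans (sym ea) (not-injective (∧-elimʳ p)))

  kept-≢b : ∀ {x} → Kept x → x ≢ b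
  kept-≢b p refl = true≢false (trans (sym eb) (not-injective (∧-elimʳ p)))

  dart-sa : IsDart (s a)
  dart-sa = s-dart a da

  dart-sb : IsDart (s b)
  dart-sb = s-dart b db

  ssa≢a : s (s a) ≢ a
  ssa≢a h = s-no-fixpoint a da (trans (sym (cong s h)) triangle)

  sb≢b : s b ≢ b
  sb≢b = s-no-fixpoint b db

  sb≢a : s b ≢ a
  sb≢a h = faceA≢faceB (trans (sym (face-≡ dart-sb da h)) (face-s b db))

  kept-sa : Kept (s a)
  kept-sa = kept (s a) dart-sa (s-no-fixpoint a da) (λ h → b≢sa (sym h))

  kept-sb : Kept (s b)
  kept-sb = kept (s b) dart-sb sb≢a sb≢b

  s'-cases : ∀ x → (s x ≡ a × s' x ≡ s b) ⊎ (s x ≡ b × s' x ≡ s a) ⊎ (e (s x) ≡ false × s' x ≡ s x)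
  s'-cases x with e (s x) in h
  ... | false = inj₂ (inj₂ (refl , refl))
  ... | true with e⇒a⊎b (s x) h
  ...   | inj₁ y = inj₁ (y , cong s (trans (cong σ y) σa))
  ...   | inj₂ y = inj₂ (inj₁ (y , cong s (trans (cong σ y) σb)))

  s'-at-a : ∀ x → s x ≡ a → s' x ≡ s b
  s'-at-a x h with s'-cases x
  ... | inj₁ (_ , y)        = y
  ... | inj₂ (inj₁ (y , _)) = ⊥-elim (b≢a (trans (sym y) h))
  ... | inj₂ (inj₂ (y , _)) = ⊥-elim (true≢false (trans (sym ea) (trans (cong e (sym h)) y)))

  s'-at-b : ∀ x → s x ≡ b → s' x ≡ s a
  s'-at-b x h with s'-cases x
  ... | inj₁ (y , _)        = ⊥-elim (b≢a (trans (sym h) y))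
  ... | inj₂ (inj₁ (_ , y)) = y
  ... | inj₂ (inj₂ (y , _)) = ⊥-elim (true≢false (trans (sym eb) (trans (cong e (sym h)) y)))

  s'-elsewhere : ∀ x → s x ≢ a → s x ≢ b → s' x ≡ s x
  s'-elsewhere x na nb with s'-cases x
  ... | inj₁ (y , _)        = ⊥-elim (na y)
  ... | inj₂ (inj₁ (y , _)) = ⊥-elim (nb y)
  ... | inj₂ (inj₂ (_ , y)) = y

  s'-kept : ∀ x → Kept x → Kept (s' x)
  s'-kept x p with s'-cases x
  ... | inj₁ (_ , y)        = subst Kept (sym y) kept-sb
  ... | inj₂ (inj₁ (_ , y)) = subst Kept (sym y) kept-sa
  ... | inj₂ (inj₂ (h , y)) = subst Kept (sym y) (∧-intro (s-dart x (kept⇒dart p)) (cong not h))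

  iter-kept : ∀ k x → Kept x → Kept (iter s' k x)
  iter-kept zero    x p = p
  iter-kept (suc k) x p = s'-kept _ (iter-kept k x p)

  Merged : Fin (suc F') → Set
  Merged i = i ≡ faceA ⊎ i ≡ faceB

  merged? : ∀ i → Dec (Merged i)
  merged? i with i FP.≟ faceA | i FP.≟ faceB
  ... | yes h | _     = yes (inj₁ h)
  ... | no _  | yes h = yes (inj₂ h)
  ... | no n₁ | no n₂ = no λ { (inj₁ h) → n₁ h ; (inj₂ h) → n₂ h }

  merge : Fin (suc F') → Fin F'
  merge i with i FP.≟ faceB
  ... | yes _ = punchOut {i = faceB} {j = faceA} (λ h → faceA≢faceB (sym h))
  ... | no ne = punchOut {i = faceB} {j = i} (λ h → ne (sym h))

  merge-≢faceB : ∀ i (ne : i ≢ faceB) → merge i ≡ punchOut {i = faceB} {j = i} (λ h → ne (sym h))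
  merge-≢faceB i ne with i FP.≟ faceB
  ... | yes h = ⊥-elim (ne h)
  ... | no _  = FP.punchOut-cong faceB refl

  merge-faceB : merge faceB ≡ punchOut {i = faceB} {j = faceA} (λ h → faceA≢faceB (sym h))
  merge-faceB with faceB FP.≟ faceB
  ... | yes _ = refl
  ... | no ne = ⊥-elim (ne refl)

  merge-merged : ∀ {i j} → Merged i → Merged j → merge i ≡ merge j
  merge-merged hi hj = trans (to-faceB hi) (sym (to-faceB hj))
    where
    to-faceB : ∀ {k} → Merged k → merge k ≡ merge faceB
    to-faceB (inj₁ refl) = trans (merge-≢faceB faceA faceA≢faceB) (trans (FP.punchOut-cong faceB refl) (sym merge-faceB))
    to-faceB (inj₂ refl) = refl

  merge-injective : ∀ i j → merge i ≡ merge j → i ≡ j ⊎ (Merged i × Merged j)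
  merge-injective i j h = by-cases (i FP.≟ faceB) (j FP.≟ faceB)
    where
    by-cases : Dec (i ≡ faceB) → Dec (j ≡ faceB) → i ≡ j ⊎ (Merged i × Merged j)
    by-cases (yes hi) (yes hj) = inj₂ (inj₂ hi , inj₂ hj)
    by-cases (yes hi) (no nj)  = inj₂ (inj₂ hi , inj₁ (sym (FP.punchOut-injective _ (λ x → nj (sym x))
      (trans (sym merge-faceB) (trans (cong merge (sym hi)) (trans h (merge-≢faceB j nj)))))))
    by-cases (no ni)  (yes hj) = inj₂ (inj₁ (FP.punchOut-injective (λ x → ni (sym x)) _
      (trans (sym (merge-≢faceB i ni)) (trans h (trans (cong merge hj) merge-faceB)))) , inj₂ hj)
    by-cases (no ni)  (no nj)  = inj₁ (FP.punchOut-injective (λ x → ni (sym x)) (λ x → nj (sym x))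
      (trans (sym (merge-≢faceB i ni)) (trans h (merge-≢faceB j nj))))

  face' : Σ X Kept → Fin F'
  face' (x , p) = merge (face (x , kept⇒dart p))

  face'-≡ : ∀ {x y} (p : Kept x) (q : Kept y) → x ≡ y → face' (x , p) ≡ face' (y , q)
  face'-≡ p q refl = cong (λ z → face' (_ , z)) (≡true-irrelevant p q)

  face'-s' : ∀ x (p : Kept x) → face' (x , p) ≡ face' (s' x , s'-kept x p)
  face'-s' x p = by-cases (s'-cases x)
    where
    dx = kept⇒dart p
    dx' = kept⇒dart (s'-kept x p)
    face-sx : ∀ {y} (q : IsDart y) → s x ≡ y → face (x , dx) ≡ face (y , q)
    face-sx q h = trans (sym (face-s x dx)) (face-≡ (s-dart x dx) q h)
    by-cases : (s x ≡ a × s' x ≡ s b) ⊎ (s x ≡ b × s' x ≡ s a) ⊎ (e (s x) ≡ false × s' x ≡ s x) →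
               face' (x , p) ≡ face' (s' x , s'-kept x p)
    by-cases (inj₁ (h , y)) =
      merge-merged (inj₁ (face-sx da h)) (inj₂ (trans (face-≡ dx' dart-sb y) (face-s b db)))
    by-cases (inj₂ (inj₁ (h , y))) =
      merge-merged (inj₂ (face-sx db h)) (inj₁ (trans (face-≡ dx' dart-sa y) (face-s a da)))
    by-cases (inj₂ (inj₂ (_ , y))) = cong merge (face-sx dx' (sym y))

  face'-iter : ∀ k x (p : Kept x) → face' (x , p) ≡ face' (iter s' k x , iter-kept k x p)
  face'-iter zero    x p = refl
  face'-iter (suc k) x p = trans (face'-iter k x p) (face'-s' _ (iter-kept k x p))

  face'-complete : ∀ t t' → (∃ λ k → iter s' k (proj₁ t) ≡ proj₁ t') → face' t ≡ face' t'
  face'-complete (x , p) (y , q) (k , h) = trans (face'-iter k x p) (face'-≡ _ q h)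

  Reaches : X → X → Set
  Reaches x y = ∃ λ k → iter s' k x ≡ y

  reaches-trans : ∀ {x y z} → Reaches x y → Reaches y z → Reaches x z
  reaches-trans {x} (k , h) (j , h') = j + k , trans (iter-+ s' j k x) (trans (cong (iter s' j) h) h')

  reaches-step : ∀ {x y} → s' x ≡ y → Reaches x y
  reaches-step h = 1 , h

  sa-reaches-ssa : Reaches (s a) (s (s a))
  sa-reaches-ssa = reaches-step (s'-elsewhere (s a) ssa≢a (λ h → b≢ssa (sym h)))

  ssa-reaches-sb : Reaches (s (s a)) (s b)
  ssa-reaches-sb = reaches-step (s'-at-a (s (s a)) triangle)

  sa-reaches-sb : Reaches (s a) (s b)
  sa-reaches-sb = reaches-trans sa-reaches-ssa ssa-reaches-sb

  s-avoids-a : ∀ x (p : IsDart x) → face (x , p) ≡ faceB → s x ≢ a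
  s-avoids-a x p l h = faceA≢faceB (trans (sym (face-≡ (s-dart x p) da h)) (trans (face-s x p) l))

  faceB-reaches-sa : ∀ k x (p : IsDart x) → face (x , p) ≡ faceB → x ≢ b → iter s k x ≡ b → Reaches x (s a)
  faceB-reaches-sa zero    x p l x≢b h = ⊥-elim (x≢b h)
  faceB-reaches-sa (suc k) x p l x≢b h with s x ≟X b
  ... | yes sx≡b = reaches-step (s'-at-b x sx≡b)
  ... | no sx≢b  = reaches-trans (reaches-step (s'-elsewhere x (s-avoids-a x p l) sx≢b))
                     (faceB-reaches-sa k (s x) (s-dart x p) (trans (face-s x p) l) sx≢b
                                       (trans (sym (iter-sucʳ s k x)) h))

  -- Passing b under s corresponds to the detour s a, s (s a), s b under s'.
  mutual
    faceB-reaches : ∀ k y x (p : IsDart y) → face (y , p) ≡ faceB → y ≢ b → x ≢ b → iter s k y ≡ x →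
      Reaches y x
    faceB-reaches zero    y x p l y≢b x≢b h = 0 , h
    faceB-reaches (suc k) y x p l y≢b x≢b h with s y ≟X b
    ... | yes sy≡b = reaches-trans (reaches-step (s'-at-b y sy≡b)) (reaches-trans sa-reaches-sb
                       (sb-reaches k x x≢b (trans (sym (cong (iter s k) sy≡b)) (trans (sym (iter-sucʳ s k y)) h))))
    ... | no sy≢b  = reaches-trans (reaches-step (s'-elsewhere y (s-avoids-a y p l) sy≢b))
                       (faceB-reaches k (s y) x (s-dart y p) (trans (face-s y p) l) sy≢b x≢b
                                      (trans (sym (iter-sucʳ s k y)) h))

    sb-reaches : ∀ k x → x ≢ b → iter s k b ≡ x → Reaches (s b) x
    sb-reaches zero    x x≢b h = ⊥-elim (x≢b (sym h))
    sb-reaches (suc k) x x≢b h =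
      faceB-reaches k (s b) x dart-sb (face-s b db) sb≢b x≢b (trans (sym (iter-sucʳ s k b)) h)

  sb-reaches-sa : Reaches (s b) (s a)
  sb-reaches-sa with face-sound (s b , dart-sb) (b , db) (face-s b db)
  ... | k , h = faceB-reaches-sa k (s b) dart-sb (face-s b db) sb≢b h

  merged-reaches-sb : ∀ x (p : Kept x) → Merged (face (x , kept⇒dart p)) → Reaches x (s b)
  merged-reaches-sb x p (inj₁ l) with faceA-members x (kept⇒dart p) l
  ... | inj₁ h        = ⊥-elim (kept-≢a p h)
  ... | inj₂ (inj₁ h) = subst (λ z → Reaches z (s b)) (sym h) sa-reaches-sb
  ... | inj₂ (inj₂ h) = subst (λ z → Reaches z (s b)) (sym h) ssa-reaches-sb
  merged-reaches-sb x p (inj₂ l) with face-sound (x , kept⇒dart p) (b , db) l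
  ... | k , h = reaches-trans (faceB-reaches-sa k x (kept⇒dart p) l (kept-≢b p) h) sa-reaches-sb

  sb-reaches-merged : ∀ x (p : Kept x) → Merged (face (x , kept⇒dart p)) → Reaches (s b) x
  sb-reaches-merged x p (inj₁ l) with faceA-members x (kept⇒dart p) l
  ... | inj₁ h        = ⊥-elim (kept-≢a p h)
  ... | inj₂ (inj₁ h) = subst (Reaches (s b)) (sym h) sb-reaches-sa
  ... | inj₂ (inj₂ h) = subst (Reaches (s b)) (sym h) (reaches-trans sb-reaches-sa sa-reaches-ssa)
  sb-reaches-merged x p (inj₂ l) with face-sound (s b , dart-sb) (x , kept⇒dart p) (trans (face-s b db) (sym l))
  ... | k , h = faceB-reaches k (s b) x dart-sb (face-s b db) sb≢b (kept-≢b p) h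

  s'-agrees : ∀ j x (p : IsDart x) → ¬ Merged (face (x , p)) → iter s' j x ≡ iter s j x
  s'-agrees zero    x p unmerged = refl
  s'-agrees (suc j) x p unmerged with s'-cases (iter s j x)
  ... | inj₁ (h , _) =
    ⊥-elim (unmerged (inj₁ (trans (sym (face-iter (suc j) x p)) (face-≡ (iter-dart (suc j) x p) da h))))
  ... | inj₂ (inj₁ (h , _)) =
    ⊥-elim (unmerged (inj₂ (trans (sym (face-iter (suc j) x p)) (face-≡ (iter-dart (suc j) x p) db h))))
  ... | inj₂ (inj₂ (_ , y)) = trans (cong s' (s'-agrees j x p unmerged)) y

  face'-sound : ∀ t t' → face' t ≡ face' t' → ∃ λ k → iter s' k (proj₁ t) ≡ proj₁ t'
  face'-sound (x , p) (y , q) h with merge-injective _ _ h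
  ... | inj₂ (mx , my) = reaches-trans (merged-reaches-sb x p mx) (sb-reaches-merged y q my)
  ... | inj₁ eq with merged? (face (x , kept⇒dart p))
  ...   | yes mx = reaches-trans (merged-reaches-sb x p mx) (sb-reaches-merged y q (subst Merged eq mx))
  ...   | no nm with face-sound (x , kept⇒dart p) (y , kept⇒dart q) eq
  ...     | k , hk = k , trans (s'-agrees k x (kept⇒dart p) nm) hk

  merge-punchIn : ∀ y → merge (punchIn faceB y) ≡ y
  merge-punchIn y = trans (merge-≢faceB _ (FP.punchInᵢ≢i faceB y))
                          (trans (FP.punchOut-cong faceB refl) (FP.punchOut-punchIn faceB))

  face'-surjective : ∀ y → ∃ λ t → face' t ≡ y
  face'-surjective y with face-surjective (punchIn faceB y)
  ... | (x , p) , h with x ≟X a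
  ...   | yes x≡a = (s a , kept-sa) ,
                    trans (cong merge (trans (face-≡ _ dart-sa refl) (trans (face-s a da) (trans (face-≡ da p (sym x≡a)) h)))) (merge-punchIn y)
  ...   | no x≢a with x ≟X b
  ...     | yes x≡b = ⊥-elim (FP.punchInᵢ≢i faceB y (trans (sym h) (face-≡ p db x≡b)))
  ...     | no x≢b = (x , kept x p x≢a x≢b) , trans (cong merge (trans (face-≡ _ p refl) h)) (merge-punchIn y)

module TriangleEdgeDeletion (G : Graph) (R : RotationSystem G) (u v : Fin (Graph.n G))
  (auv : Graph.adj G u v ≡ true) (triangle : iter (faceStep G R) 3 (u , v) ≡ (u , v)) where
  open Graph G renaming (sym to adj-symmetric)
  open RotationSystem R

  w : Fin n
  w = rot v u

  avu : adj v u ≡ true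
  avu = adj-sym G auv

  avw : adj v w ≡ true
  avw = closed v u avu

  awv : adj w v ≡ true
  awv = adj-sym G avw

  awu : adj w u ≡ true
  awu = subst (λ t → adj w t ≡ true) (cong proj₁ triangle) (closed w v awv)

  auw : adj u w ≡ true
  auw = adj-sym G awu

  u≢v : u ≢ v
  u≢v = adj⇒≢ G auv

  v≢w : v ≢ w
  v≢w = adj⇒≢ G avw

  w≢u : w ≢ u
  w≢u = adj⇒≢ G awu

  rot-uv≢v : rot u v ≢ v
  rot-uv≢v fixed with cyclic u v w auv auw
  ... | k , h = v≢w (trans (sym (iter-fixed (rot u) fixed k)) h)

  deleted : Fin n → Fin n → Bool
  deleted x y = (x == u ∧ y == v) ∨ (x == v ∧ y == u)

  deleted⇒ : ∀ x y → deleted x y ≡ true → (x ≡ u × y ≡ v) ⊎ (x ≡ v × y ≡ u)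
  deleted⇒ x y h with x == u in x=u | y == v in y=v
  ... | true  | true  = inj₁ (==⇒≡ x=u , ==⇒≡ y=v)
  ... | true  | false = inj₂ (==⇒≡ (∧-elimˡ h) , ==⇒≡ (∧-elimʳ h))
  ... | false | _     = inj₂ (==⇒≡ (∧-elimˡ h) , ==⇒≡ (∧-elimʳ h))

  deleted-false : ∀ x y → (x ≡ u → y ≢ v) → (x ≡ v → y ≢ u) → deleted x y ≡ false
  deleted-false x y h₁ h₂ with deleted x y in e
  ... | false = refl
  ... | true with deleted⇒ x y e
  ...   | inj₁ (x≡u , y≡v) = ⊥-elim (h₁ x≡u y≡v)
  ...   | inj₂ (x≡v , y≡u) = ⊥-elim (h₂ x≡v y≡u)

  deleted-falseˡ : ∀ x y → x ≢ u → x ≢ v → deleted x y ≡ false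
  deleted-falseˡ x y x≢u x≢v = deleted-false x y (λ e → ⊥-elim (x≢u e)) (λ e → ⊥-elim (x≢v e))

  deleted-falseʳ : ∀ x y → y ≢ u → y ≢ v → deleted x y ≡ false
  deleted-falseʳ x y y≢u y≢v = deleted-false x y (λ _ → y≢v) (λ _ → y≢u)

  deleted-uv : deleted u v ≡ true
  deleted-uv rewrite ==-refl u | ==-refl v = refl

  deleted-vu : deleted v u ≡ true
  deleted-vu rewrite ==-refl u | ==-refl v | ≢⇒==-false (λ e → u≢v (sym e)) = refl

  deleted-sym : ∀ x y → deleted x y ≡ deleted y x
  deleted-sym x y = trans (∨-comm (x == u ∧ y == v) (x == v ∧ y == u))
                          (cong₂ _∨_ (∧-comm (x == v) (y == u)) (∧-comm (x == u) (y == v)))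

  G-uv : Graph
  G-uv = record
    { n      = n
    ; adj    = λ x y → adj x y ∧ not (deleted x y)
    ; sym    = λ x y → cong₂ (λ a b → a ∧ not b) (adj-symmetric x y) (deleted-sym x y)
    ; irrefl = λ x → cong (λ a → a ∧ not (deleted x x)) (irrefl x)
    }

  kept-edge : ∀ {x y} → adj x y ≡ true → deleted x y ≡ false → Adj G-uv x y
  kept-edge axy not-deleted = ∧-intro axy (cong not not-deleted)

  deleted-rot : ∀ x t → deleted x t ≡ true → deleted x (rot x t) ≡ false
  deleted-rot x t h with deleted⇒ x t h
  ... | inj₁ (refl , refl) = deleted-false u (rot u v) (λ _ → rot-uv≢v) (λ e → ⊥-elim (u≢v e))
  ... | inj₂ (refl , refl) = deleted-false v w (λ e → ⊥-elim (u≢v (sym e))) (λ _ → w≢u)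

  R-uv : RotationSystem G-uv
  R-uv = record { rot = rot' ; closed = closed' ; cyclic = cyclic' }
    where
    rot' : Fin n → Fin n → Fin n
    rot' x = Skipping.skip (rot x) (deleted x)

    closed' : ∀ x y → Adj G-uv x y → Adj G-uv x (rot' x y)
    closed' x y a with deleted x (rot x y) in h
    ... | true  = kept-edge (closed x (rot x y) (closed x y (∧-elimˡ a))) (deleted-rot x (rot x y) h)
    ... | false = kept-edge (closed x y (∧-elimˡ a)) h

    cyclic' : ∀ x y z → Adj G-uv x y → Adj G-uv x z → ∃ λ k → iter (rot' x) k y ≡ z
    cyclic' x y z ay az with cyclic x y z (∧-elimˡ ay) (∧-elimˡ az)
    ... | k , h = Skipping.skip-reaches (rot x) (deleted x) k y z (not-injective (∧-elimʳ az)) h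

  maxDegree-G-uv : ∀ {k} → MaxDegreeAtMost G k → MaxDegreeAtMost G-uv k
  maxDegree-G-uv Δ≤k x = ≤-trans (count-mono {q = adj x} (λ y → ∧-elimˡ)) (Δ≤k x)

  kept-uw : Adj G-uv u w
  kept-uw = kept-edge auw (deleted-false u w (λ _ w≡v → v≢w (sym w≡v)) (λ u≡v → ⊥-elim (u≢v u≡v)))

  kept-vw : Adj G-uv v w
  kept-vw = kept-edge avw (deleted-false v w (λ v≡u → ⊥-elim (u≢v (sym v≡u))) (λ _ → w≢u))

  kept-wu : Adj G-uv w u
  kept-wu = kept-edge awu (deleted-falseˡ w u w≢u (λ w≡v → v≢w (sym w≡v)))

  kept-wv : Adj G-uv w v
  kept-wv = kept-edge awv (deleted-falseˡ w v w≢u (λ w≡v → v≢w (sym w≡v)))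

  edge⇒path-G-uv : ∀ {x y} → Adj G x y → Star (Adj G-uv) x y
  edge⇒path-G-uv {x} {y} axy with deleted x y in e
  ... | false = kept-edge axy e ◅ ε
  ... | true with deleted⇒ x y e
  ...   | inj₁ (refl , refl) = kept-uw ◅ kept-wv ◅ ε
  ...   | inj₂ (refl , refl) = kept-vw ◅ kept-wu ◅ ε

  numComponents-G-uv : ∀ {c} → NumComponents G c → NumComponents G-uv c
  numComponents-G-uv (ℓ , surj , sound , complete) =
    ℓ , surj , (λ x y ℓx≡ℓy → (edge⇒path-G-uv ⋆) (sound x y ℓx≡ℓy)) ,
    (λ x y path → complete x y (Star.map ∧-elimˡ path))

  isolated-G-uv : ∀ x → (degree G-uv x ≡ᵇ 0) ≡ (degree G x ≡ᵇ 0)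
  isolated-G-uv x = by-cases (x FP.≟ u) (x FP.≟ v)
    where
    by-cases : Dec (x ≡ u) → Dec (x ≡ v) → (degree G-uv x ≡ᵇ 0) ≡ (degree G x ≡ᵇ 0)
    by-cases (yes refl) _ = trans (positive⇒≡ᵇ0-false (count-pos _ w kept-uw))
                                  (sym (positive⇒≡ᵇ0-false (count-pos (adj u) v auv)))
    by-cases (no _) (yes refl) = trans (positive⇒≡ᵇ0-false (count-pos _ w kept-vw))
                                       (sym (positive⇒≡ᵇ0-false (count-pos (adj v) w avw)))
    by-cases (no x≢u) (no x≢v) = cong (_≡ᵇ 0) (count-cong (λ y →
      trans (cong (λ b → adj x y ∧ not b) (deleted-falseˡ x y x≢u x≢v)) (∧-identityʳ (adj x y))))

  numIsolated-G-uv : numIsolated G-uv ≡ numIsolated G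
  numIsolated-G-uv = count-cong isolated-G-uv

  deleted-unique : ∀ p q → deleted p q ≡ true → ∀ x y → deleted x y ≡ true → (x ≡ p × y ≡ q) ⊎ (x ≡ q × y ≡ p)
  deleted-unique p q pq x y xy with deleted⇒ p q pq | deleted⇒ x y xy
  ... | inj₁ (refl , refl) | xy≡ = xy≡
  ... | inj₂ (refl , refl) | inj₁ xy≡ = inj₂ xy≡
  ... | inj₂ (refl , refl) | inj₂ xy≡ = inj₁ xy≡

  before : Fin n → Fin n → Bool
  before x y = toℕ x <ᵇ toℕ y

  -- numEdges counts the deleted edge {p , q} at its endpoint p of smaller index only.
  numEdges-G-uv-at : ∀ p q → deleted p q ≡ true → adj p q ≡ true → before p q ≡ true →
    numEdges G ≡ suc (numEdges G-uv)
  numEdges-G-uv-at p q pq-deleted apq p<q = sumFin-suc-at _ _ p at-p elsewhere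
    where
    deleted-at-p : ∀ y → deleted p y ≡ (y == q)
    deleted-at-p y with y FP.≟ q
    ... | yes y≡q = trans (cong (deleted p) y≡q) pq-deleted
    ... | no y≢q with deleted p y in e
    ...   | false = refl
    ...   | true with deleted-unique p q pq-deleted p y e
    ...     | inj₁ (_ , y≡q) = ⊥-elim (y≢q y≡q)
    ...     | inj₂ (p≡q , _) = ⊥-elim (adj⇒≢ G apq p≡q)

    at-p : count (λ y → adj p y ∧ before p y) ≡ suc (count (λ y → (adj p y ∧ not (deleted p y)) ∧ before p y))
    at-p = trans (count-remove _ q (∧-intro apq p<q)) (cong suc (count-cong λ y →
             sym (trans (∧-not-swap (adj p y) (deleted p y) (before p y))
                        (cong (λ b → (adj p y ∧ before p y) ∧ not b) (deleted-at-p y)))))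

    elsewhere : ∀ x → x ≢ p →
      count (λ y → adj x y ∧ before x y) ≡ count (λ y → (adj x y ∧ not (deleted x y)) ∧ before x y)
    elsewhere x x≢p = count-cong (λ y → sym (∧-not-redundant (adj x y) (deleted x y) (before x y) (not-before y)))
      where
      not-before : ∀ y → deleted x y ≡ true → before x y ≡ false
      not-before y xy with deleted-unique p q pq-deleted x y xy
      ... | inj₁ (x≡p , _)     = ⊥-elim (x≢p x≡p)
      ... | inj₂ (refl , refl) = <ᵇ-asym {toℕ p} {toℕ q} p<q

  numEdges-G-uv : numEdges G ≡ suc (numEdges G-uv)
  numEdges-G-uv with <-cmp (toℕ u) (toℕ v)
  ... | tri< u<v _ _ = numEdges-G-uv-at u v deleted-uv auv (Equivalence.to T-≡ (<⇒<ᵇ u<v))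
  ... | tri≈ _ u≡v _ = ⊥-elim (u≢v (FP.toℕ-injective u≡v))
  ... | tri> _ _ v<u = numEdges-G-uv-at v u deleted-vu avu (Equivalence.to T-≡ (<⇒<ᵇ v<u))

  size-G-uv : size G-uv < size G
  size-G-uv = ≤-reflexive (trans (sym (+-suc n (numEdges G-uv))) (cong (n +_) (sym numEdges-G-uv)))

  reverse : Fin n × Fin n → Fin n × Fin n
  reverse (x , y) = (y , x)

  isDart : Fin n × Fin n → Bool
  isDart p = adj (proj₁ p) (proj₂ p)

  isDeleted : Fin n × Fin n → Bool
  isDeleted p = deleted (proj₁ p) (proj₂ p)

  faceStep-dart : ∀ p → isDart p ≡ true → isDart (faceStep G R p) ≡ true
  faceStep-dart (x , y) axy = closed y x (adj-sym G axy)

  faceStep-no-fixpoint : ∀ p → isDart p ≡ true → faceStep G R p ≢ p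
  faceStep-no-fixpoint (x , y) axy fixed = adj⇒≢ G axy (sym (cong proj₁ fixed))

  isDeleted⇒ : ∀ p → isDeleted p ≡ true → p ≡ (u , v) ⊎ p ≡ (v , u)
  isDeleted⇒ (x , y) h with deleted⇒ x y h
  ... | inj₁ (refl , refl) = inj₁ refl
  ... | inj₂ (refl , refl) = inj₂ refl

  vu-off-triangle : (v , u) ≢ (u , v) × (v , u) ≢ faceStep G R (u , v) × (v , u) ≢ faceStep G R (faceStep G R (u , v))
  vu-off-triangle = (λ e → u≢v (sym (cong proj₁ e))) , (λ e → w≢u (sym (cong proj₂ e))) , (λ e → v≢w (cong proj₁ e))

  numFaces-G-uv : ∀ {F'} → NumFaces G R (suc F') → NumFaces G-uv R-uv F'
  numFaces-G-uv {F'} (face , surjective , sound , complete) =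
    M.face' , M.face'-surjective , sound' , complete'
    where
    module M = FaceMerge (≡-dec FP._≟_ FP._≟_) (faceStep G R) reverse isDart isDeleted F' face surjective sound complete
                 faceStep-dart faceStep-no-fixpoint (u , v) (v , u) auv avu deleted-uv deleted-vu isDeleted⇒
                 refl refl triangle (proj₁ vu-off-triangle) (proj₁ (proj₂ vu-off-triangle)) (proj₂ (proj₂ vu-off-triangle))

    faceStep-G-uv : ∀ p → faceStep G-uv R-uv p ≡ M.s' p
    faceStep-G-uv (x , y) with deleted y (rot y x)
    ... | true  = refl
    ... | false = refl

    iter-G-uv : ∀ k p → iter (faceStep G-uv R-uv) k p ≡ iter M.s' k p
    iter-G-uv = iter-cong (faceStep G-uv R-uv) faceStep-G-uv

    sound' : ∀ t t' → M.face' t ≡ M.face' t' → SameFace G-uv R-uv t t'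
    sound' t t' same with M.face'-sound t t' same
    ... | k , h = k , trans (iter-G-uv k (proj₁ t)) h

    complete' : ∀ t t' → SameFace G-uv R-uv t t' → M.face' t ≡ M.face' t'
    complete' t t' (k , h) = M.face'-complete t t' (k , trans (sym (iter-G-uv k (proj₁ t))) h)

  plane-G-uv : IsPlane G R → IsPlane G-uv R-uv
  plane-G-uv (zero , c , (face , _) , _) = ⊥-elim (FP.¬Fin0 (face ((u , v) , auv)))
  plane-G-uv (suc F' , c , faces , components , euler) =
    F' , c , numFaces-G-uv faces , numComponents-G-uv components , suc-injective (begin
      suc (n + F' + numIsolated G-uv)  ≡⟨ cong₂ _+_ (sym (+-suc n F')) numIsolated-G-uv ⟩
      n + suc F' + numIsolated G       ≡⟨ euler ⟩
      numEdges G + 2 * c               ≡⟨ cong (_+ 2 * c) numEdges-G-uv ⟩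
      suc (numEdges G-uv + 2 * c)      ∎)
    where open ≡-Reasoning

  Dist≤2-G-uv : ∀ x y → x ≢ u → x ≢ v → y ≢ u → y ≢ v → Dist≤2 G x y → Dist≤2 G-uv x y
  Dist≤2-G-uv x y x≢u x≢v y≢u y≢v (inj₁ axy) = inj₁ (kept-edge axy (deleted-falseˡ x y x≢u x≢v))
  Dist≤2-G-uv x y x≢u x≢v y≢u y≢v (inj₂ (m , axm , amy)) =
    inj₂ (m , kept-edge axm (deleted-falseˡ x m x≢u x≢v) , kept-edge amy (deleted-falseʳ m y y≢u y≢v))

  colouring-from-G-uv : MaxDegreeAtMost G 5 → degree G u ≡ 4 → degree G v ≡ 4 → degree G w ≡ 4 →
    χ₂≤ G-uv 17 → χ₂≤ G 17
  colouring-from-G-uv Δ≤5 du dv dw (j , j≤17 , φ , φ-proper) =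
    17 , ≤-refl , ψ₂ , λ x y x≢y xy → ψ₂-proper x y x≢y xy tt tt
    where
    ψ₀ : Fin n → Fin 17
    ψ₀ x = inject≤ (φ x) j≤17

    ψ₀-proper : ProperOn G (λ x → x ≢ v × x ≢ u) ψ₀
    ψ₀-proper x y x≢y xy (x≢v , x≢u) (y≢v , y≢u) same =
      φ-proper x y x≢y (Dist≤2-G-uv x y x≢u x≢v y≢u y≢v xy) (FP.inject≤-injective j≤17 j≤17 _ _ same)

    free-u = FreeColour.unusedColour G Δ≤5 u v w auv auw avw du dv dw ψ₀

    ψ₁ : Fin n → Fin 17
    ψ₁ = recolour G u (proj₁ free-u) ψ₀

    ψ₁-proper : ProperOn G (_≢ v) ψ₁
    ψ₁-proper = recolour-proper G u (proj₁ free-u) ψ₀ ψ₀-proper (proj₂ free-u)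

    free-v = FreeColour.unusedColour G Δ≤5 v u w avu avw auw dv du dw ψ₁

    ψ₂ : Fin n → Fin 17
    ψ₂ = recolour G v (proj₁ free-v) ψ₁

    ψ₂-proper : ProperOn G (λ _ → ⊤) ψ₂
    ψ₂-proper = recolour-proper G v (proj₁ free-v) ψ₁
                  (λ x y x≢y xy (_ , x≢v) (_ , y≢v) → ψ₁-proper x y x≢y xy x≢v y≢v) (proj₂ free-v)

lemma6 : (P : PlaneGraph) → MinimalCounterexample P →
    ¬ (∃ λ d → Is3Face (PlaneGraph.graph P) (PlaneGraph.embedding P) d ×
         (let (a , b , c) = boundaryVertices3 (PlaneGraph.graph P) (PlaneGraph.embedding P) d
          in degree (PlaneGraph.graph P) a ≡ 4 × degree (PlaneGraph.graph P) b ≡ 4 ×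
             degree (PlaneGraph.graph P) c ≡ 4))
lemma6 P (Δ≤5 , not-colourable , minimal) (((u , v) , auv) , (triangle , _) , (du , dv , dw)) =
  not-colourable (colouring-from-G-uv Δ≤5 du dv dw
    (minimal G-uv (R-uv , plane-G-uv (PlaneGraph.plane P)) (maxDegree-G-uv Δ≤5) size-G-uv))
  where open TriangleEdgeDeletion (PlaneGraph.graph P) (PlaneGraph.embedding P) u v auv triangle
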